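{- Let $G$ be a finite group and $d$ a bi-invariant metric on $G$. Then $$G\rtimes\operatorname{Aut}_{ecp}(G)\le\Gamma(G,d)\le\mathbb{S}_G.$$ In particular, if $G$ is abelian then $G\rtimes\operatorname{Aut}_{ecp}(G)=\mathbb{D}(G)$.
   Context: A metric $d$ on $G$ is bi-invariant if $d(gh,g'h)=d(g,g')=d(hg,hg')$ for all $g,g',h\in G$. $\mathbb{S}_G$ is the group of all permutations of the set $G$, and $\Gamma(G,d)=\{\sigma\in\mathbb{S}_G: d(\sigma(x),\sigma(y))=d(x,y)\ \forall x,y\}$. An automorphism $\sigma$ of $G$ is class-preserving if for every $g$ there is $h$ with $\sigma(g)=hgh^{ -1}$, and class-inverting if for every $g$ there is $h$ with $\sigma(g)=hg^{ -1}h^{ -1}$; $\operatorname{Aut}_{ecp}(G)$ is the subgroup of $\operatorname{Aut}(G)$ of automorphisms sending each element either into its own conjugacy class or into the conjugacy class of its inverse. $G\rtimes\operatorname{Aut}_{ecp}(G)$ is regarded as the subgroup of $\mathbb{S}_G$ generated by the right translations $x\mapsto xg$ ($g\in G$) and the permutations given by elements of $\operatorname{Aut}_{ecp}(G)$. For abelian $G$, $\mathbb{D}(G)=G\rtimes\langle i\rangle$ is the subgroup of $\mathbb{S}_G$ generated by translations and the inversion $i:g\mapsto g^{ -1}$. -}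

module Defs where

open import Level using (Level; _⊔_; suc; 0ℓ)
open import Data.Nat using (ℕ)
open import Data.Fin using (Fin)
open import Data.Product using (Σ; _×_; _,_; ∃)
open import Data.Sum using (_⊎_)
open import Algebra.Structures using (IsGroup)
open import Relation.Binary.PropositionalEquality using (_≡_)

-- A finite group: carrier Fin n (any finite group is isomorphic to one of
-- these), with the group laws w.r.t. propositional equality.
record FiniteGroup : Set where
  field
    order : ℕ
    _∙_   : Fin order → Fin order → Fin order
    ε     : Fin order
    _⁻¹   : Fin order → Fin order
    isGroup : IsGroup _≡_ _∙_ ε _⁻¹

  Carrier : Set
  Carrier = Fin order

-- Codomain of a metric: a type with zero, addition and an order.
-- (Stands in for ℝ, which is unavailable; ℝ is one instance.)
record MetricCodomain : Set₁ where
  field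
    V    : Set
    0V   : V
    _+_  : V → V → V
    _≤_  : V → V → Set

module _ (G : FiniteGroup) where
  open FiniteGroup G

  record IsMetric (M : MetricCodomain) (d : Carrier → Carrier → MetricCodomain.V M) : Set where
    open MetricCodomain M
    field
      nonneg   : ∀ x y → 0V ≤ d x y
      zero⇒eq  : ∀ x y → d x y ≡ 0V → x ≡ y
      eq⇒zero  : ∀ x → d x x ≡ 0V
      symmetric : ∀ x y → d x y ≡ d y x
      triangle : ∀ x y z → d x z ≤ (d x y + d y z)

  IsBiInvariant : {V : Set} → (Carrier → Carrier → V) → Set
  IsBiInvariant d = ∀ g g' h → (d (g ∙ h) (g' ∙ h) ≡ d g g') × (d (h ∙ g) (h ∙ g') ≡ d g g')

  record Perm : Set where
    field
      to      : Carrier → Carrier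
      from    : Carrier → Carrier
      to∘from : ∀ x → to (from x) ≡ x
      from∘to : ∀ x → from (to x) ≡ x
  open Perm public

  PermSet : Set₁
  PermSet = Perm → Set

  -- subgroup of 𝕊_G generated by a set X of permutations
  -- (group operation is composition, equality is pointwise)
  data ⟨_⟩ (X : PermSet) : PermSet where
    gen : ∀ {σ} → X σ → ⟨ X ⟩ σ
    one : ∀ {σ} → (∀ x → to σ x ≡ x) → ⟨ X ⟩ σ
    mul : ∀ {σ τ ρ} → ⟨ X ⟩ σ → ⟨ X ⟩ τ → (∀ x → to ρ x ≡ to σ (to τ x)) → ⟨ X ⟩ ρ
    inv : ∀ {σ ρ} → ⟨ X ⟩ σ → (∀ x → to ρ x ≡ from σ x) → ⟨ X ⟩ ρ

  record IsSubgroup (H : PermSet) : Set where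
    field
      has-one : ∀ σ → (∀ x → to σ x ≡ x) → H σ
      has-mul : ∀ σ τ ρ → H σ → H τ → (∀ x → to ρ x ≡ to σ (to τ x)) → H ρ
      has-inv : ∀ σ ρ → H σ → (∀ x → to ρ x ≡ from σ x) → H ρ

  _⊆_ : PermSet → PermSet → Set
  K ⊆ H = ∀ σ → K σ → H σ

  Γ : {V : Set} → (Carrier → Carrier → V) → PermSet
  Γ d σ = ∀ x y → d (to σ x) (to σ y) ≡ d x y

  IsRightTranslation : Perm → Set
  IsRightTranslation σ = Σ Carrier λ g → ∀ x → to σ x ≡ x ∙ g

  IsAutomorphism : Perm → Set
  IsAutomorphism σ = ∀ x y → to σ (x ∙ y) ≡ to σ x ∙ to σ y

  IsECP : Perm → Set
  IsECP σ = IsAutomorphism σ ×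
            (∀ g → Σ Carrier λ h → (to σ g ≡ (h ∙ g) ∙ (h ⁻¹)) ⊎ (to σ g ≡ (h ∙ (g ⁻¹)) ∙ (h ⁻¹)))

  -- G ⋊ Aut_ecp(G) as a subgroup of 𝕊_G
  G⋊Autecp : PermSet
  G⋊Autecp = ⟨ (λ σ → IsRightTranslation σ ⊎ IsECP σ) ⟩

  𝔻 : PermSet
  𝔻 = ⟨ (λ σ → IsRightTranslation σ ⊎ (∀ x → to σ x ≡ x ⁻¹)) ⟩

  IsAbelian : Set
  IsAbelian = ∀ x y → x ∙ y ≡ y ∙ x

{-# OPTIONS --safe #-}
module Submission where

-- A bi-invariant metric is determined by the norm ‖ z ‖ = d z ε through
-- d x y = ‖ x ∙ y ⁻¹ ‖, and bi-invariance plus symmetry make this norm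
-- invariant under conjugation and inversion. Hence an automorphism sending each
-- element into its own or its inverse's conjugacy class preserves the norm and is
-- an isometry; right translations are isometries outright, and isometries form a
-- subgroup of 𝕊_G, so they contain the generated group G ⋊ Aut_ecp(G).
-- In an abelian group conjugation is trivial, so an ecp-automorphism fixes or
-- inverts each element. If it fixed a and inverted b, the image of a ∙ b, namely
-- a ∙ b ⁻¹, would force b = b ⁻¹ or a = a ⁻¹; so it is the identity or the
-- inversion throughout, and conversely the inversion is an ecp-automorphism.

open import Defs
open import Level using (0ℓ)
open import Data.Product using (_×_; _,_; proj₁; proj₂)
open import Data.Sum using (_⊎_; inj₁; inj₂)
open import Data.Fin.Properties using (_≟_; all?; ¬∀⟶∃¬)
open import Relation.Nullary using (yes; no; contradiction)
open import Relation.Binary.PropositionalEquality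
open import Algebra.Bundles using (Group)
open import Algebra.Structures using (IsGroup)
import Algebra.Properties.Group as GroupProperties

module _ (G : FiniteGroup) where
  -- FiniteGroup declares no fixities, so x ∙ y ⁻¹ would not parse otherwise.
  open FiniteGroup G renaming (_∙_ to infixl 7 _∙_; _⁻¹ to infix 8 _⁻¹)
  open IsGroup isGroup using (assoc; identityˡ; identityʳ; inverseʳ)
  open ≡-Reasoning

  group : Group 0ℓ 0ℓ
  group = record { isGroup = isGroup }

  open GroupProperties group
    using (∙-cancelˡ; ∙-cancelʳ; identityʳ-unique; inverseˡ-unique; ε⁻¹≈ε; ⁻¹-anti-homo-∙)

  ⟨⟩-isSubgroup : (X : PermSet G) → IsSubgroup G (⟨_⟩ G X)
  ⟨⟩-isSubgroup X = record
    { has-one = λ _ → one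
    ; has-mul = λ _ _ _ → mul
    ; has-inv = λ _ _ → inv
    }

  ⟨⟩-least : ∀ {X H : PermSet G} → IsSubgroup G H → _⊆_ G X H → _⊆_ G (⟨_⟩ G X) H
  ⟨⟩-least H≤ X⊆H σ (gen x)              = X⊆H σ x
  ⟨⟩-least H≤ X⊆H σ (one e)              = IsSubgroup.has-one H≤ σ e
  ⟨⟩-least H≤ X⊆H σ (mul {σ₁} {τ} p q e) =
    IsSubgroup.has-mul H≤ σ₁ τ σ (⟨⟩-least H≤ X⊆H σ₁ p) (⟨⟩-least H≤ X⊆H τ q) e
  ⟨⟩-least H≤ X⊆H σ (inv {σ₁} p e)       =
    IsSubgroup.has-inv H≤ σ₁ σ (⟨⟩-least H≤ X⊆H σ₁ p) e

  Γ-isSubgroup : ∀ {V : Set} (d : Carrier → Carrier → V) → IsSubgroup G (Γ G d)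
  Γ-isSubgroup d = record
    { has-one = λ σ σ≗id x y → cong₂ d (σ≗id x) (σ≗id y)
    ; has-mul = λ σ τ ρ σ∈Γ τ∈Γ ρ≗στ x y →
        trans (cong₂ d (ρ≗στ x) (ρ≗στ y)) (trans (σ∈Γ _ _) (τ∈Γ x y))
    ; has-inv = λ σ ρ σ∈Γ ρ≗σ⁻¹ x y → begin
        d (to ρ x) (to ρ y)                        ≡⟨ cong₂ d (ρ≗σ⁻¹ x) (ρ≗σ⁻¹ y) ⟩
        d (from σ x) (from σ y)                    ≡⟨ σ∈Γ (from σ x) (from σ y) ⟨
        d (to σ (from σ x)) (to σ (from σ y))      ≡⟨ cong₂ d (to∘from σ x) (to∘from σ y) ⟩
        d x y                                      ∎
    }

  automorphism-ε : (σ : Perm G) → IsAutomorphism G σ → to σ ε ≡ ε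
  automorphism-ε σ hom = identityʳ-unique (to σ ε) (to σ ε)
    (trans (sym (hom ε ε)) (cong (to σ) (identityˡ ε)))

  automorphism-⁻¹ : (σ : Perm G) → IsAutomorphism G σ → ∀ x → to σ (x ⁻¹) ≡ to σ x ⁻¹
  automorphism-⁻¹ σ hom x = inverseˡ-unique (to σ (x ⁻¹)) (to σ x) (begin
    to σ (x ⁻¹) ∙ to σ x  ≡⟨ hom (x ⁻¹) x ⟨
    to σ (x ⁻¹ ∙ x)       ≡⟨ cong (to σ) (IsGroup.inverseˡ isGroup x) ⟩
    to σ ε                ≡⟨ automorphism-ε σ hom ⟩
    ε                     ∎)

  conj-ε : ∀ g → (ε ∙ g) ∙ ε ⁻¹ ≡ g
  conj-ε g = trans (cong₂ _∙_ (identityˡ g) ε⁻¹≈ε) (identityʳ g)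

  module BiInvariant {V : Set} (d : Carrier → Carrier → V)
                     (d-sym : ∀ x y → d x y ≡ d y x) (d-bi : IsBiInvariant G d) where

    ‖_‖ : Carrier → V
    ‖ z ‖ = d z ε

    d≡‖∙⁻¹‖ : ∀ x y → d x y ≡ ‖ x ∙ y ⁻¹ ‖
    d≡‖∙⁻¹‖ x y = begin
      d x y                      ≡⟨ proj₁ (d-bi x y (y ⁻¹)) ⟨
      d (x ∙ y ⁻¹) (y ∙ y ⁻¹)    ≡⟨ cong (d (x ∙ y ⁻¹)) (inverseʳ y) ⟩
      ‖ x ∙ y ⁻¹ ‖               ∎

    ‖‖-conj : ∀ h z → ‖ (h ∙ z) ∙ h ⁻¹ ‖ ≡ ‖ z ‖
    ‖‖-conj h z = begin
      d ((h ∙ z) ∙ h ⁻¹) ε         ≡⟨ d≡‖∙⁻¹‖ (h ∙ z) h ⟨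
      d (h ∙ z) h                  ≡⟨ cong (d (h ∙ z)) (identityʳ h) ⟨
      d (h ∙ z) (h ∙ ε)            ≡⟨ proj₂ (d-bi z ε h) ⟩
      d z ε                        ∎

    ‖‖-⁻¹ : ∀ z → ‖ z ⁻¹ ‖ ≡ ‖ z ‖
    ‖‖-⁻¹ z = begin
      d (z ⁻¹) ε                 ≡⟨ proj₂ (d-bi (z ⁻¹) ε z) ⟨
      d (z ∙ z ⁻¹) (z ∙ ε)       ≡⟨ cong₂ d (inverseʳ z) (identityʳ z) ⟩
      d ε z                      ≡⟨ d-sym ε z ⟩
      d z ε                      ∎

    ecp-preserves-‖‖ : ∀ σ → IsECP G σ → ∀ z → ‖ to σ z ‖ ≡ ‖ z ‖
    ecp-preserves-‖‖ σ (_ , classes) z with classes z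
    ... | h , inj₁ σz≡conj = trans (cong ‖_‖ σz≡conj) (‖‖-conj h z)
    ... | h , inj₂ σz≡conj⁻¹ =
      trans (cong ‖_‖ σz≡conj⁻¹) (trans (‖‖-conj h (z ⁻¹)) (‖‖-⁻¹ z))

    ecp∈Γ : ∀ σ → IsECP G σ → Γ G d σ
    ecp∈Γ σ ecp@(hom , _) x y = begin
      d (to σ x) (to σ y)             ≡⟨ d≡‖∙⁻¹‖ (to σ x) (to σ y) ⟩
      ‖ to σ x ∙ to σ y ⁻¹ ‖          ≡⟨ cong (λ w → ‖ to σ x ∙ w ‖) (automorphism-⁻¹ σ hom y) ⟨
      ‖ to σ x ∙ to σ (y ⁻¹) ‖        ≡⟨ cong ‖_‖ (hom x (y ⁻¹)) ⟨
      ‖ to σ (x ∙ y ⁻¹) ‖             ≡⟨ ecp-preserves-‖‖ σ ecp (x ∙ y ⁻¹) ⟩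
      ‖ x ∙ y ⁻¹ ‖                    ≡⟨ d≡‖∙⁻¹‖ x y ⟨
      d x y                           ∎

    rightTranslation∈Γ : ∀ σ → IsRightTranslation G σ → Γ G d σ
    rightTranslation∈Γ σ (g , σ≗∙g) x y =
      trans (cong₂ d (σ≗∙g x) (σ≗∙g y)) (proj₁ (d-bi x y g))

    G⋊Autecp⊆Γ : _⊆_ G (G⋊Autecp G) (Γ G d)
    G⋊Autecp⊆Γ = ⟨⟩-least (Γ-isSubgroup d) generator∈Γ
      where
      generator∈Γ : ∀ σ → IsRightTranslation G σ ⊎ IsECP G σ → Γ G d σ
      generator∈Γ σ (inj₁ translation) = rightTranslation∈Γ σ translation
      generator∈Γ σ (inj₂ ecp)         = ecp∈Γ σ ecp

  module Abelian (comm : IsAbelian G) where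

    conj-trivial : ∀ h g → (h ∙ g) ∙ h ⁻¹ ≡ g
    conj-trivial h g = begin
      (h ∙ g) ∙ h ⁻¹   ≡⟨ cong (_∙ h ⁻¹) (comm h g) ⟩
      (g ∙ h) ∙ h ⁻¹   ≡⟨ assoc g h (h ⁻¹) ⟩
      g ∙ (h ∙ h ⁻¹)   ≡⟨ cong (g ∙_) (inverseʳ h) ⟩
      g ∙ ε            ≡⟨ identityʳ g ⟩
      g                ∎

    ecp-fixes-or-inverts : ∀ σ → IsECP G σ → ∀ g → to σ g ≡ g ⊎ to σ g ≡ g ⁻¹
    ecp-fixes-or-inverts σ (_ , classes) g with classes g
    ... | h , inj₁ σg≡conj   = inj₁ (trans σg≡conj (conj-trivial h g))
    ... | h , inj₂ σg≡conj⁻¹ = inj₂ (trans σg≡conj⁻¹ (conj-trivial h (g ⁻¹)))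

    fixed-inverted-clash : ∀ σ → IsECP G σ → ∀ a b → to σ a ≡ a → to σ b ≡ b ⁻¹ →
                           to σ a ≡ a ⁻¹ ⊎ to σ b ≡ b
    fixed-inverted-clash σ ecp@(hom , _) a b σa≡a σb≡b⁻¹
      with ecp-fixes-or-inverts σ ecp (a ∙ b)
    ... | inj₁ σab≡ab = inj₂ (trans σb≡b⁻¹ (∙-cancelˡ a (b ⁻¹) b (begin
      a ∙ b ⁻¹            ≡⟨ cong₂ _∙_ σa≡a σb≡b⁻¹ ⟨
      to σ a ∙ to σ b     ≡⟨ hom a b ⟨
      to σ (a ∙ b)        ≡⟨ σab≡ab ⟩
      a ∙ b               ∎)))
    ... | inj₂ σab≡ab⁻¹ = inj₁ (trans σa≡a (∙-cancelʳ (b ⁻¹) a (a ⁻¹) (begin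
      a ∙ b ⁻¹            ≡⟨ cong₂ _∙_ σa≡a σb≡b⁻¹ ⟨
      to σ a ∙ to σ b     ≡⟨ hom a b ⟨
      to σ (a ∙ b)        ≡⟨ σab≡ab⁻¹ ⟩
      (a ∙ b) ⁻¹          ≡⟨ ⁻¹-anti-homo-∙ a b ⟩
      b ⁻¹ ∙ a ⁻¹         ≡⟨ comm (b ⁻¹) (a ⁻¹) ⟩
      a ⁻¹ ∙ b ⁻¹         ∎)))

    ecp-identity-or-inversion : ∀ σ → IsECP G σ →
                                (∀ g → to σ g ≡ g) ⊎ (∀ g → to σ g ≡ g ⁻¹)
    ecp-identity-or-inversion σ ecp with all? (λ g → to σ g ≟ g)
    ... | yes σ≗id = inj₁ σ≗id
    ... | no σ≉id with ¬∀⟶∃¬ order _ (λ g → to σ g ≟ g) σ≉id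
    ...   | b , σb≢b = inj₂ σ≗⁻¹
      where
      σb≡b⁻¹ : to σ b ≡ b ⁻¹
      σb≡b⁻¹ with ecp-fixes-or-inverts σ ecp b
      ... | inj₁ σb≡b   = contradiction σb≡b σb≢b
      ... | inj₂ σb≡b⁻¹ = σb≡b⁻¹

      σ≗⁻¹ : ∀ a → to σ a ≡ a ⁻¹
      σ≗⁻¹ a with ecp-fixes-or-inverts σ ecp a
      ... | inj₂ σa≡a⁻¹ = σa≡a⁻¹
      ... | inj₁ σa≡a with fixed-inverted-clash σ ecp a b σa≡a σb≡b⁻¹
      ...   | inj₁ σa≡a⁻¹ = σa≡a⁻¹
      ...   | inj₂ σb≡b   = contradiction σb≡b σb≢b

    inversion-ecp : ∀ σ → (∀ x → to σ x ≡ x ⁻¹) → IsECP G σ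
    inversion-ecp σ σ≗⁻¹ = hom , λ g → ε , inj₂ (trans (σ≗⁻¹ g) (sym (conj-ε (g ⁻¹))))
      where
      hom : IsAutomorphism G σ
      hom x y = begin
        to σ (x ∙ y)        ≡⟨ σ≗⁻¹ (x ∙ y) ⟩
        (x ∙ y) ⁻¹          ≡⟨ ⁻¹-anti-homo-∙ x y ⟩
        y ⁻¹ ∙ x ⁻¹         ≡⟨ comm (y ⁻¹) (x ⁻¹) ⟩
        x ⁻¹ ∙ y ⁻¹         ≡⟨ cong₂ _∙_ (σ≗⁻¹ x) (σ≗⁻¹ y) ⟨
        to σ x ∙ to σ y     ∎

    G⋊Autecp⊆𝔻 : _⊆_ G (G⋊Autecp G) (𝔻 G)
    G⋊Autecp⊆𝔻 = ⟨⟩-least (⟨⟩-isSubgroup _) generator∈𝔻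
      where
      generator∈𝔻 : ∀ σ → IsRightTranslation G σ ⊎ IsECP G σ → 𝔻 G σ
      generator∈𝔻 σ (inj₁ translation) = gen (inj₁ translation)
      generator∈𝔻 σ (inj₂ ecp) with ecp-identity-or-inversion σ ecp
      ... | inj₁ σ≗id = one σ≗id
      ... | inj₂ σ≗⁻¹ = gen (inj₂ σ≗⁻¹)

    𝔻⊆G⋊Autecp : _⊆_ G (𝔻 G) (G⋊Autecp G)
    𝔻⊆G⋊Autecp = ⟨⟩-least (⟨⟩-isSubgroup _) generator∈G⋊Autecp
      where
      generator∈G⋊Autecp : ∀ σ → IsRightTranslation G σ ⊎ (∀ x → to σ x ≡ x ⁻¹) →
                           G⋊Autecp G σ
      generator∈G⋊Autecp σ (inj₁ translation) = gen (inj₁ translation)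
      generator∈G⋊Autecp σ (inj₂ σ≗⁻¹)        = gen (inj₂ (inversion-ecp σ σ≗⁻¹))

proposition3p3 : (G : FiniteGroup) (M : MetricCodomain)
    (d : FiniteGroup.Carrier G → FiniteGroup.Carrier G → MetricCodomain.V M) →
    IsMetric G M d → IsBiInvariant G d →
    (_⊆_ G (G⋊Autecp G) (Γ G d) × IsSubgroup G (Γ G d)) ×
    (IsAbelian G → _⊆_ G (G⋊Autecp G) (𝔻 G) × _⊆_ G (𝔻 G) (G⋊Autecp G))
proposition3p3 G M d metric d-bi =
  (G⋊Autecp⊆Γ , Γ-isSubgroup G d) ,
  λ comm → let open Abelian G comm in G⋊Autecp⊆𝔻 , 𝔻⊆G⋊Autecp
  where open BiInvariant G d (IsMetric.symmetric metric) d-bi
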